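{- Let $\mathbb C$ be an internal category in $\mathcal S$ with finite products and let $\mathrm{Cof}$ be a propositional universe in $\mathcal S$ such that, for all objects $c,c'$ of $\mathbb C$, the equality predicate on $\mathbb C(c,c')$ belongs to $\mathrm{Cof}$ (i.e. for $\sigma,\tau:\mathbb C(c,c')$ the proposition $\sigma=\tau$ has a code in $\mathrm{Cof}$). Then for every object $c$ of $\mathbb C$, the equality predicate on the representable presheaf $\mathbf y c$ belongs to $[\mathbb C^{op},\mathrm{Cof}]$ in $\mathrm{PSh}(\mathbb C)$. In particular, for a path connection algebra $(\mathbb I,\delta_0,\delta_1,\mu_0,\mu_1)$ in $\mathbb C$, in $\mathrm{PSh}(\mathbb C)$ one has codes $i:\mathbf y\mathbb I\vdash (i=0):[\mathbb C^{op},\mathrm{Cof}]$ and $i:\mathbf y\mathbb I\vdash (i=1):[\mathbb C^{op},\mathrm{Cof}]$, where $0,1$ are the elements of $\mathbf y\mathbb I$ induced by $\delta_0,\delta_1$.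
   Context: Let $\mathcal S$ be a model of extensional dependent type theory (category with families) with dependent products, dependent sums, extensional identity types, unit type, disjoint finite coproducts and propositional truncation; we use its internal language. A universe is a closed type $U$ with a family $\mathrm{el}_U$; it is propositional if each $\mathrm{el}_U(A)$ is a proposition (any two elements equal); a proposition "belongs to" or "has a code in" $U$ if it is equivalent to $\mathrm{el}_U$ of some code. An internal category $\mathbb C$ has a type of objects, morphism types $\mathbb C(c_0,c_1)$, identities and composition. A presheaf on $\mathbb C$ is a family $A(c)$ with a right action; $\mathrm{El}(A)$ is its category of elements. The presheaf model $\mathrm{PSh}(\mathbb C)$: contexts are presheaves, types over $\Gamma$ are presheaves on $\mathrm{El}(\Gamma)$, terms are sections, with pointwise identity types. $\mathbf y c$ is the representable presheaf $\mathbb C(-,c)$. The Hofmann–Streicher lifting $[\mathbb C^{op},U]$ of a universe $U$ is the presheaf with $[\mathbb C^{op},U](c)$ the type of functors $(\mathbb C/c)^{op}\to U$ ($U$ viewed as a category with morphisms $\mathrm{el}_U(A)\to\mathrm{el}_U(B)$), action by precomposition, and $\mathrm{el}(c,A):=\mathrm{el}_U(A(\mathrm{id}_c))$. A path connection algebra in $\mathbb C$ (with finite products, terminal object $1$) is an object $\mathbb I$ with $\delta_0,\delta_1:\mathbb C(1,\mathbb I)$ and $\mu_0,\mu_1:\mathbb C(\mathbb I\times\mathbb I,\mathbb I)$ such that $\mu_e(\delta_e\times\mathbb I)=\mu_e(\mathbb I\times\delta_e)=\delta_e$ and $\mu_e(\delta_{\bar e}\times\mathbb I)=\mu_e(\mathbb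 I\times\delta_{\bar e})=\mathrm{id}$ for $e\in\{0,1\}$, $\bar0=1,\bar1=0$. -}

module Defs where

open import Data.Product using (Σ; _×_; _,_; proj₁; proj₂)
open import Function.Bundles using (_⇔_)
open import Relation.Binary.PropositionalEquality using (_≡_; refl; sym; trans; cong; cong₂)

-- The ambient model 𝒮 is rendered by Agda's own type theory (types in Set).

record Category : Set₁ where
  infixr 9 _∘_
  field
    Obj   : Set
    Hom   : Obj → Obj → Set
    idC   : ∀ {c} → Hom c c
    _∘_   : ∀ {c₀ c₁ c₂} → Hom c₁ c₂ → Hom c₀ c₁ → Hom c₀ c₂
    idˡ   : ∀ {c₀ c₁} (f : Hom c₀ c₁) → idC ∘ f ≡ f
    idʳ   : ∀ {c₀ c₁} (f : Hom c₀ c₁) → f ∘ idC ≡ f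
    assoc : ∀ {c₀ c₁ c₂ c₃} (h : Hom c₂ c₃) (g : Hom c₁ c₂) (f : Hom c₀ c₁) →
            (h ∘ g) ∘ f ≡ h ∘ (g ∘ f)

record FiniteProducts (C : Category) : Set where
  open Category C
  field
    𝟙      : Obj
    !      : ∀ {c} → Hom c 𝟙
    !-uniq : ∀ {c} (f : Hom c 𝟙) → f ≡ !
    _×ₒ_   : Obj → Obj → Obj
    π₁     : ∀ {a b} → Hom (a ×ₒ b) a
    π₂     : ∀ {a b} → Hom (a ×ₒ b) b
    ⟨_,_⟩  : ∀ {c a b} → Hom c a → Hom c b → Hom c (a ×ₒ b)
    π₁-β   : ∀ {c a b} (f : Hom c a) (g : Hom c b) → π₁ ∘ ⟨ f , g ⟩ ≡ f
    π₂-β   : ∀ {c a b} (f : Hom c a) (g : Hom c b) → π₂ ∘ ⟨ f , g ⟩ ≡ g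
    ⟨⟩-uniq : ∀ {c a b} (h : Hom c (a ×ₒ b)) → ⟨ π₁ ∘ h , π₂ ∘ h ⟩ ≡ h

record Universe : Set₁ where
  field
    Code : Set
    el   : Code → Set

IsPropositional : Universe → Set
IsPropositional U = ∀ (A : Universe.Code U) (x y : Universe.el U A) → x ≡ y

-- A proposition P has a code in U (P and el_U(A) are propositions, so
-- equivalence is logical equivalence).
HasCode : Universe → Set → Set
HasCode U P = Σ (Universe.Code U) (λ A → Universe.el U A ⇔ P)

HomEqualityHasCodes : Category → Universe → Set
HomEqualityHasCodes C U =
  ∀ (c c' : Category.Obj C) (σ τ : Category.Hom C c c') → HasCode U (σ ≡ τ)

module HS (C : Category) (U : Universe) where
  open Category C
  open Universe U

  -- an element of [ℂ^op,U](c): a functor (ℂ/c)^op → U.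
  -- A morphism (e,f) → (e',f') in ℂ/c is g : Hom e e' with f' ∘ g ≡ f;
  -- it is sent to a map el(A f') → el(A f).
  record HSObj (c : Obj) : Set where
    field
      ob    : ∀ {e} → Hom e c → Code
      mor   : ∀ {e e'} {f : Hom e c} {f' : Hom e' c} (g : Hom e e') →
              f' ∘ g ≡ f → el (ob f') → el (ob f)
      mor-id : ∀ {e} {f : Hom e c} (p : f ∘ idC ≡ f) (x : el (ob f)) →
               mor idC p x ≡ x
      mor-∘ : ∀ {e e' e''} {f : Hom e c} {f' : Hom e' c} {f'' : Hom e'' c}
              (g : Hom e e') (h : Hom e' e'')
              (p : f' ∘ g ≡ f) (q : f'' ∘ h ≡ f') (r : f'' ∘ (h ∘ g) ≡ f)
              (x : el (ob f'')) →
              mor (h ∘ g) r x ≡ mor g p (mor h q x)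
  open HSObj public

  -- Extensional equality of such functors (object parts agree; the
  -- morphism parts then agree automatically as U is propositional and
  -- 𝒮 is extensional).
  _≈_ : ∀ {c} → HSObj c → HSObj c → Set
  _≈_ {c} A B = ∀ {e} (f : Hom e c) → ob A f ≡ ob B f

  private
    reindex-eq : ∀ {d d' e e'} (g : Hom d' d) {f : Hom e d'} {f' : Hom e' d'}
                 (h : Hom e e') → f' ∘ h ≡ f → (g ∘ f') ∘ h ≡ g ∘ f
    reindex-eq g {f} {f'} h p = trans (assoc g f' h) (cong (g ∘_) p)

  -- restriction action of [ℂ^op,U] along g : d' → d (precomposition)
  _·_ : ∀ {d d'} → HSObj d → Hom d' d → HSObj d'
  ob (A · g) f = ob A (g ∘ f)
  mor (A · g) h p = mor A h (reindex-eq g h p)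
  mor-id (A · g) p x = mor-id A _ x
  mor-∘ (A · g) h k p q r x = mor-∘ A h k _ _ _ x

  El : ∀ {c} → HSObj c → Set
  El A = el (ob A idC)

  -- A term  x : 𝐲c, y : 𝐲c ⊢ φ : [ℂ^op,U]  in PSh(ℂ): a section of the
  -- presheaf [ℂ^op,U] over the context 𝐲c × 𝐲c, i.e. a natural family.
  record Tm-yc² (c : Obj) : Set where
    field
      φ   : ∀ {d} → Hom d c → Hom d c → HSObj d
      nat : ∀ {d d'} (g : Hom d' d) (σ τ : Hom d c) →
            (φ σ τ · g) ≈ φ (σ ∘ g) (τ ∘ g)
  open Tm-yc² public

  -- A term  i : 𝐲a ⊢ φ : [ℂ^op,U]  in PSh(ℂ).
  record Tm-y (a : Obj) : Set where
    field
      ψ    : ∀ {d} → Hom d a → HSObj d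
      natψ : ∀ {d d'} (g : Hom d' d) (i : Hom d a) → (ψ i · g) ≈ ψ (i ∘ g)
  open Tm-y public

  -- The equality predicate on 𝐲c (x,y : 𝐲c ⊢ x = y, pointwise identity
  -- type) belongs to [ℂ^op,U]: a code whose decoding is equivalent to
  -- the identity type at every stage.
  YonedaEqualityHasCode : Obj → Set
  YonedaEqualityHasCode c =
    Σ (Tm-yc² c) λ t → ∀ {d} (σ τ : Hom d c) → El (φ t σ τ) ⇔ (σ ≡ τ)

module _ (C : Category) (P : FiniteProducts C) where
  open Category C
  open FiniteProducts P

  record PathConnectionAlgebra : Set where
    field
      𝕀  : Obj
      δ₀ : Hom 𝟙 𝕀
      δ₁ : Hom 𝟙 𝕀
      μ₀ : Hom (𝕀 ×ₒ 𝕀) 𝕀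
      μ₁ : Hom (𝕀 ×ₒ 𝕀) 𝕀
      -- μ_e (δ_e × 𝕀) = μ_e (𝕀 × δ_e) = δ_e
      -- μ_e (δ_ē × 𝕀) = μ_e (𝕀 × δ_ē) = id
      -- (as maps 𝕀 ≅ 𝟙 × 𝕀 → 𝕀, resp. 𝕀 ≅ 𝕀 × 𝟙 → 𝕀)
      μ₀-δ₀ˡ : μ₀ ∘ ⟨ δ₀ ∘ ! , idC ⟩ ≡ δ₀ ∘ !
      μ₀-δ₀ʳ : μ₀ ∘ ⟨ idC , δ₀ ∘ ! ⟩ ≡ δ₀ ∘ !
      μ₀-δ₁ˡ : μ₀ ∘ ⟨ δ₁ ∘ ! , idC ⟩ ≡ idC
      μ₀-δ₁ʳ : μ₀ ∘ ⟨ idC , δ₁ ∘ ! ⟩ ≡ idC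
      μ₁-δ₁ˡ : μ₁ ∘ ⟨ δ₁ ∘ ! , idC ⟩ ≡ δ₁ ∘ !
      μ₁-δ₁ʳ : μ₁ ∘ ⟨ idC , δ₁ ∘ ! ⟩ ≡ δ₁ ∘ !
      μ₁-δ₀ˡ : μ₁ ∘ ⟨ δ₀ ∘ ! , idC ⟩ ≡ idC
      μ₁-δ₀ʳ : μ₁ ∘ ⟨ idC , δ₀ ∘ ! ⟩ ≡ idC

  -- the global element of 𝐲𝕀 induced by δ : 1 → 𝕀, at stage d
  pt : ∀ {a d} → Hom 𝟙 a → Hom d a
  pt δ = δ ∘ !

  -- i : 𝐲a ⊢ (i = δ) has a code in [ℂ^op,U]
  PointEqualityHasCode : (U : Universe) (a : Obj) → Hom 𝟙 a → Set
  PointEqualityHasCode U a δ =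
    Σ (HS.Tm-y C U a) λ t → ∀ {d} (i : Hom d a) →
      HS.El C U (HS.Tm-y.ψ t i) ⇔ (i ≡ pt δ)

module Submission where

-- Fix σ, τ : 𝐲c(d) = ℂ(d,c).  The Hofmann–Streicher code of
-- the identity type σ = τ at stage d is the functor (ℂ/d)^op → Cof sending
-- f : e → d to the Cof-code of the hom-equality σ ∘ f = τ ∘ f; its action
-- on morphisms of ℂ/d transports such equalities by whiskering, and the
-- functor laws hold because Cof is propositional.  Reindexing this functor
-- along g is, by associativity, the functor for (σ ∘ g, τ ∘ g), which is
-- naturality; decoding it at f = id gives σ ∘ id = τ ∘ id, i.e. σ = τ.
--
-- The statement about path connection algebras is an instance of a
-- general substitution lemma: any code for equality on 𝐲a yields, for each
-- global element δ : 1 → a, a code for  i : 𝐲a ⊢ i = δ,  by plugging the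
-- constant (hence natural) family δ ∘ ! into the second variable.

open import Defs
open import Data.Product using (_×_; _,_; proj₁; proj₂)
open import Function.Bundles using (_⇔_; mk⇔; Equivalence)
open import Relation.Binary.PropositionalEquality
  using (_≡_; sym; trans; cong; cong₂; module ≡-Reasoning)

module YonedaEquality (C : Category) (Cof : Universe)
                      (Cof-prop : IsPropositional Cof)
                      (homEq : HomEqualityHasCodes C Cof) where
  open Category C
  open Universe Cof
  open HS C Cof

  eqCode : ∀ {a b} (σ τ : Hom a b) → Code
  eqCode σ τ = proj₁ (homEq _ _ σ τ)

  decode : ∀ {a b} {σ τ : Hom a b} → el (eqCode σ τ) → σ ≡ τ
  decode {σ = σ} {τ} = Equivalence.to (proj₂ (homEq _ _ σ τ))

  encode : ∀ {a b} {σ τ : Hom a b} → σ ≡ τ → el (eqCode σ τ)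
  encode {σ = σ} {τ} = Equivalence.from (proj₂ (homEq _ _ σ τ))

  -- Equalities after precomposition are stable under further
  -- precomposition: this is the action of the equality functor on a
  -- morphism g : (e,f) → (e',f') of the slice ℂ/d.
  whisker : ∀ {d e e' c} {σ τ : Hom d c} {f : Hom e d} {f' : Hom e' d}
            (g : Hom e e') → f' ∘ g ≡ f → σ ∘ f' ≡ τ ∘ f' → σ ∘ f ≡ τ ∘ f
  whisker {σ = σ} {τ} {f} {f'} g f'g≡f σf'≡τf' = begin
    σ ∘ f         ≡⟨ cong (σ ∘_) (sym f'g≡f) ⟩
    σ ∘ (f' ∘ g)  ≡⟨ sym (assoc σ f' g) ⟩
    (σ ∘ f') ∘ g  ≡⟨ cong (_∘ g) σf'≡τf' ⟩
    (τ ∘ f') ∘ g  ≡⟨ assoc τ f' g ⟩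
    τ ∘ (f' ∘ g)  ≡⟨ cong (τ ∘_) f'g≡f ⟩
    τ ∘ f         ∎
    where open ≡-Reasoning

  Equality : ∀ {c d} → Hom d c → Hom d c → HSObj d
  ob     (Equality σ τ) f              = eqCode (σ ∘ f) (τ ∘ f)
  mor    (Equality σ τ) g p x          = encode (whisker g p (decode x))
  mor-id (Equality σ τ) _ _            = Cof-prop _ _ _
  mor-∘  (Equality σ τ) _ _ _ _ _ _    = Cof-prop _ _ _

  Equality-natural : ∀ {c d d'} (g : Hom d' d) (σ τ : Hom d c) →
                     (Equality σ τ · g) ≈ Equality (σ ∘ g) (τ ∘ g)
  Equality-natural g σ τ f = cong₂ eqCode (sym (assoc σ g f)) (sym (assoc τ g f))

  Equality-decodes : ∀ {c d} (σ τ : Hom d c) → El (Equality σ τ) ⇔ (σ ≡ τ)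
  Equality-decodes σ τ = mk⇔
    (λ x → trans (sym (idʳ σ)) (trans (decode x) (idʳ τ)))
    (λ σ≡τ → encode (cong (_∘ idC) σ≡τ))

  yonedaEquality : ∀ c → YonedaEqualityHasCode c
  yonedaEquality c = record { φ = Equality ; nat = Equality-natural }
                   , Equality-decodes

module PointEquality (C : Category) (P : FiniteProducts C) (U : Universe) where
  open Category C
  open FiniteProducts P
  open HS C U

  pt-natural : ∀ {a d d'} (δ : Hom 𝟙 a) (g : Hom d' d) → pt C P δ ∘ g ≡ pt C P δ
  pt-natural δ g = begin
    (δ ∘ !) ∘ g  ≡⟨ assoc δ ! g ⟩
    δ ∘ (! ∘ g)  ≡⟨ cong (δ ∘_) (!-uniq (! ∘ g)) ⟩
    δ ∘ !        ∎
    where open ≡-Reasoning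

  pointEquality : ∀ {a} → YonedaEqualityHasCode a → (δ : Hom 𝟙 a) →
                  PointEqualityHasCode C P U a δ
  pointEquality {a} (t , decodes) δ = atPoint , λ i → decodes i (pt C P δ)
    where
    atPoint : Tm-y a
    ψ    atPoint i     = φ t i (pt C P δ)
    natψ atPoint g i f =
      trans (nat t g i (pt C P δ) f)
            (cong (λ (ε : Hom _ a) → ob (φ t (i ∘ g) ε) f) (pt-natural δ g))

proposition4p2 : (C : Category) (P : FiniteProducts C) (Cof : Universe) →
    IsPropositional Cof → HomEqualityHasCodes C Cof →
    ((c : Category.Obj C) → HS.YonedaEqualityHasCode C Cof c)
    × ((A : PathConnectionAlgebra C P) →
        PointEqualityHasCode C P Cof (PathConnectionAlgebra.𝕀 A) (PathConnectionAlgebra.δ₀ A)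
        × PointEqualityHasCode C P Cof (PathConnectionAlgebra.𝕀 A) (PathConnectionAlgebra.δ₁ A))
proposition4p2 C P Cof Cof-prop homEq = yonedaEquality , intervalEndpoints
  where
  open YonedaEquality C Cof Cof-prop homEq using (yonedaEquality)
  open PointEquality C P Cof using (pointEquality)

  intervalEndpoints : (A : PathConnectionAlgebra C P) →
    PointEqualityHasCode C P Cof (PathConnectionAlgebra.𝕀 A) (PathConnectionAlgebra.δ₀ A)
    × PointEqualityHasCode C P Cof (PathConnectionAlgebra.𝕀 A) (PathConnectionAlgebra.δ₁ A)
  intervalEndpoints A = pointEquality (yonedaEquality 𝕀) δ₀
                      , pointEquality (yonedaEquality 𝕀) δ₁
    where open PathConnectionAlgebra A
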